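{- Let $G_{CYK}$ be the CYK CDAG for an input string of length $n$ and a context-free grammar in Chomsky normal form in which no two rules have the same right-hand side, and let $W_1,\dots,W_{n-1}$ be its $W$-cover. For every $i$, any set of $x$ variable-root vertices contained in $W_i$ contains at most $x^2/4$ interacting pairs, and each such interacting pair forms the predecessors of a unique $L$-vertex, with distinct interacting pairs giving $L$-vertices belonging to distinct grammar-root vertices.
   Context: A context-free grammar $(V,\mathcal{R},\Sigma,T)$ has variables $V$, terminals $\Sigma$, rules $\mathcal{R}$ and start variable $T$; it is in Chomsky normal form (CNF) if every rule has the form $A\to BC$ (binary rule, $B,C$ variables other than $T$), $A\to a$ ($a\in\Sigma$), or $T\to\epsilon$. $\mathcal{R}_B$ denotes the set of binary rules. CYK CDAG $G_{CYK}$ for a string $w=w_1\cdots w_n$: for each $1\le i\le j\le n$ (subproblem $S(i,j)$, the set of variables deriving $w_i\cdots w_j$) and each variable $A\in V$ there is a variable-root (VR) vertex $v^A_{i,j}$; the vertices $v^A_{i,i}$ are inputs. For $i<j$, each $v^A_{i,j}$ is the root of a binary tree (edges directed towards the root) whose leaves are grammar-root (GR) vertices, one for each binary rule with left-hand side $A$; the GR vertex of subproblem $S(i,j)$ for rule $A\to BC$ is the root of a binary tree (edges towards the root) with $j-i$ leaves ($L$-vertices), indexed by $k\in\{i,\dots,j-1\}$, where the leaf indexed $k$ has as predecessors $v^B_{i,k}$ and $v^C_{k+1,j}$. All these trees are vertex-disjoint. Two VR vertices interact if they are the two predecessors of a common $L$-vertex. Row $r_i$ is the set of VR vertices $v^A_{i,j}$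 for all $j\ge i$ and all $A$; column $c_j$ is the set of VR vertices $v^A_{i,j}$ for all $i\le j$ and all $A$; $W_i=r_{i+1}\cup c_i$ for $1\le i\le n-1$ (the $W$-cover). -}

module Defs where

open import Data.Nat using (ℕ; suc; _≤_; _<_)
open import Data.Fin using (Fin)
open import Data.Bool using (Bool; true)
open import Data.Product using (Σ; _×_; _,_)
open import Data.Sum using (_⊎_)
open import Relation.Binary.PropositionalEquality using (_≡_; _≢_)

-- The rule set R is given by characteristic (Bool-valued) functions:
--   isBin A B C ≡ true   iff  A → BC ∈ R      (binary rules R_B)
--   isTerm A a ≡ true    iff  A → a ∈ R
--   startEps ≡ true      iff  T → ε ∈ R
-- CNF forces B, C ≠ T in binary rules.
record CNFGrammar : Set where
  field
    nV       : ℕ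
    nΣ       : ℕ
    start    : Fin nV
    isBin    : Fin nV → Fin nV → Fin nV → Bool
    isTerm   : Fin nV → Fin nΣ → Bool
    startEps : Bool
    binNoStart : ∀ A B C → isBin A B C ≡ true → (B ≢ start) × (C ≢ start)

open CNFGrammar public

NoSharedRHS : CNFGrammar → Set
NoSharedRHS G =
  (∀ A A' B C → isBin G A B C ≡ true → isBin G A' B C ≡ true → A ≡ A')
  × (∀ A A' a → isTerm G A a ≡ true → isTerm G A' a ≡ true → A ≡ A')

record VR (m : ℕ) : Set where
  constructor vr
  field
    i : ℕ
    j : ℕ
    A : Fin m

record LV (m : ℕ) : Set where
  constructor lv
  field
    i : ℕ
    j : ℕ
    k : ℕ
    A : Fin m
    B : Fin m
    C : Fin m

record GR (m : ℕ) : Set where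
  constructor gr
  field
    i : ℕ
    j : ℕ
    A : Fin m
    B : Fin m
    C : Fin m

IsVR : (G : CNFGrammar) → ℕ → VR (nV G) → Set
IsVR G n (vr i j A) = (1 ≤ i) × (i ≤ j) × (j ≤ n)

IsL : (G : CNFGrammar) → ℕ → LV (nV G) → Set
IsL G n (lv i j k A B C) =
  (1 ≤ i) × (i ≤ k) × (k < j) × (j ≤ n) × (isBin G A B C ≡ true)

leftPred : ∀ {m} → LV m → VR m
leftPred (lv i j k A B C) = vr i k B

rightPred : ∀ {m} → LV m → VR m
rightPred (lv i j k A B C) = vr (suc k) j C

grOf : ∀ {m} → LV m → GR m
grOf (lv i j k A B C) = gr i j A B C

PredPair : ∀ {m} → LV m → VR m → VR m → Set
PredPair ℓ u v =
  ((leftPred ℓ ≡ u) × (rightPred ℓ ≡ v)) ⊎ ((leftPred ℓ ≡ v) × (rightPred ℓ ≡ u))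

Interact : (G : CNFGrammar) → ℕ → VR (nV G) → VR (nV G) → Set
Interact G n u v = Σ (LV (nV G)) λ ℓ → IsL G n ℓ × PredPair ℓ u v

SamePair : ∀ {m} → VR m × VR m → VR m × VR m → Set
SamePair (u , v) (u' , v') = ((u ≡ u') × (v ≡ v')) ⊎ ((u ≡ v') × (v ≡ u'))

-- W_i = r_{i+1} ∪ c_i (restricted to VR vertices of G_CYK).
InW : (G : CNFGrammar) → ℕ → ℕ → VR (nV G) → Set
InW G n i v = IsVR G n v × ((VR.i v ≡ suc i) ⊎ (VR.j v ≡ i))

UniqueL : (G : CNFGrammar) → ℕ → VR (nV G) → VR (nV G) → Set
UniqueL G n u v =
  Σ (LV (nV G)) λ ℓ → IsL G n ℓ × PredPair ℓ u v
    × (∀ ℓ' → IsL G n ℓ' → PredPair ℓ' u v → ℓ' ≡ ℓ)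

{-# OPTIONS --safe #-}
module Submission where

-- If both predecessors v^B_{a,k} and v^C_{k+1,b} of an L-vertex lie in W_i = r_{i+1} ∪ c_i,
-- then k = i: the left one lies in the column c_i and the right one in r_{i+1} but not in c_i.
-- Putting the c_i-endpoint first therefore maps distinct interacting pairs of S injectively
-- into (S ∩ c_i) × (S ∖ c_i), so there are at most c r ≤ (c + r)²/4 = |S|²/4 of them.
-- Since all these L-vertices have k = i, each is determined by its grammar-root vertex.
-- The L-vertex of an interacting pair is unique: the pair fixes which vertex is the left
-- predecessor (it ends before the other starts), hence i, j, k, B and C, and then A is
-- determined because no two rules share a right-hand side.

open import Defs
open import Data.Nat using (ℕ; suc; _+_; _*_; _≤_; _<_; _≟_)
open import Data.Nat.Properties
  using ( ≤-total; m≤m+n; *-comm; +-comm; +-suc; m≤n⇒∃[o]m+o≡n; suc-injective; <-asym; <-irrefl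
        ; *-monoʳ-≤; module ≤-Reasoning)
open import Data.Nat.Tactic.RingSolver using (solve-∀)
open import Data.Fin using (Fin; zero; suc)
open import Data.Fin.Properties using (injective⇒≤)
open import Data.Vec using (Vec)
open import Data.List using (List; []; _∷_; length; lookup; filter; map; cartesianProduct; _++_)
open import Data.List.Properties using (length-++; length-map)
open import Data.List.Membership.Propositional using (_∈_)
open import Data.List.Membership.Propositional.Properties
  using (∈-lookup; ∈-map⁻; ∈-filter⁺; ∈-cartesianProduct⁺)
open import Data.List.Relation.Binary.Subset.Propositional using (_⊆_)
open import Data.List.Relation.Unary.All using (All)
import Data.List.Relation.Unary.All as All
open import Data.List.Relation.Unary.Any using (index)
open import Data.List.Relation.Unary.Any.Properties using (lookup-index)
open import Data.List.Relation.Unary.AllPairs using (AllPairs; _∷_)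
import Data.List.Relation.Unary.AllPairs as AllPairs
import Data.List.Relation.Unary.AllPairs.Properties as AllPairs
open import Data.List.Relation.Unary.Unique.Propositional using (Unique)
open import Data.Product using (_×_; _,_; proj₁; proj₂)
open import Data.Sum using (inj₁; inj₂; [_,_]′)
open import Data.Bool using (true; false)
open import Function.Definitions using (Injective)
open import Level using (0ℓ)
open import Relation.Nullary using (¬_; yes; no; does; contradiction)
open import Relation.Unary using (Pred; Decidable)
open import Relation.Unary.Properties using (∁?)
open import Relation.Binary.PropositionalEquality
  using (_≡_; _≢_; refl; sym; trans; cong; cong₂; subst; subst₂; module ≡-Reasoning)

module _ {a} {A : Set a} where

  Unique⇒lookup-injective : ∀ {xs : List A} → Unique xs → ∀ i j → lookup xs i ≡ lookup xs j → i ≡ j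
  Unique⇒lookup-injective (_ ∷ _) zero zero _ = refl
  Unique⇒lookup-injective (x∉xs ∷ _) zero (suc j) eq = contradiction eq (All.lookup x∉xs (∈-lookup j))
  Unique⇒lookup-injective (x∉xs ∷ _) (suc i) zero eq = contradiction (sym eq) (All.lookup x∉xs (∈-lookup i))
  Unique⇒lookup-injective (_ ∷ uniq) (suc i) (suc j) eq = cong suc (Unique⇒lookup-injective uniq i j eq)

  Unique∧⊆⇒length≤ : ∀ {xs ys : List A} → Unique xs → xs ⊆ ys → length xs ≤ length ys
  Unique∧⊆⇒length≤ {xs} {ys} uniq xs⊆ys = injective⇒≤ position-injective
    where
    position : Fin (length xs) → Fin (length ys)
    position k = index (xs⊆ys (∈-lookup k))

    lookup-position : ∀ k → lookup xs k ≡ lookup ys (position k)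
    lookup-position k = lookup-index (xs⊆ys (∈-lookup k))

    position-injective : Injective _≡_ _≡_ position
    position-injective {k} {l} eq = Unique⇒lookup-injective uniq k l (begin
      lookup xs k            ≡⟨ lookup-position k ⟩
      lookup ys (position k) ≡⟨ cong (lookup ys) eq ⟩
      lookup ys (position l) ≡⟨ lookup-position l ⟨
      lookup xs l            ∎)
      where open ≡-Reasoning

  length-filter+length-filter-∁ : ∀ {p} {P : Pred A p} (P? : Decidable P) xs →
    length (filter P? xs) + length (filter (∁? P?) xs) ≡ length xs
  length-filter+length-filter-∁ P? [] = refl
  length-filter+length-filter-∁ P? (x ∷ xs) with does (P? x)
  ... | true  = cong suc (length-filter+length-filter-∁ P? xs)
  ... | false = trans (+-suc _ _) (cong suc (length-filter+length-filter-∁ P? xs))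

length-cartesianProduct : ∀ {a b} {A : Set a} {B : Set b} (xs : List A) (ys : List B) →
  length (cartesianProduct xs ys) ≡ length xs * length ys
length-cartesianProduct [] ys = refl
length-cartesianProduct (x ∷ xs) ys = begin
  length (map (x ,_) ys ++ cartesianProduct xs ys)         ≡⟨ length-++ (map (x ,_) ys) ⟩
  length (map (x ,_) ys) + length (cartesianProduct xs ys)
    ≡⟨ cong₂ _+_ (length-map (x ,_) ys) (length-cartesianProduct xs ys) ⟩
  length ys + length xs * length ys                        ∎
  where open ≡-Reasoning

4mn≤[m+n]² : ∀ m n → 4 * (m * n) ≤ (m + n) * (m + n)
4mn≤[m+n]² m n = [ ordered , swapped ]′ (≤-total m n)
  where
  ordered : ∀ {a b} → a ≤ b → 4 * (a * b) ≤ (a + b) * (a + b)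
  ordered {a} a≤b with d , refl ← m≤n⇒∃[o]m+o≡n a≤b =
    subst (4 * (a * (a + d)) ≤_) (square a d) (m≤m+n _ (d * d))
    where
    square : ∀ a d → 4 * (a * (a + d)) + d * d ≡ (a + (a + d)) * (a + (a + d))
    square = solve-∀

  swapped : n ≤ m → 4 * (m * n) ≤ (m + n) * (m + n)
  swapped n≤m = subst₂ _≤_ (cong (4 *_) (*-comm n m)) (cong (λ s → s * s) (+-comm n m)) (ordered n≤m)

private
  variable
    m : ℕ
    ℓ ℓ′ : LV m
    u v u′ v′ : VR m

PredPair⇒SamePair : PredPair ℓ u v → PredPair ℓ u′ v′ → SamePair (u , v) (u′ , v′)
PredPair⇒SamePair (inj₁ (refl , refl)) (inj₁ (refl , refl)) = inj₁ (refl , refl)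
PredPair⇒SamePair (inj₁ (refl , refl)) (inj₂ (refl , refl)) = inj₂ (refl , refl)
PredPair⇒SamePair (inj₂ (refl , refl)) (inj₁ (refl , refl)) = inj₂ (refl , refl)
PredPair⇒SamePair (inj₂ (refl , refl)) (inj₂ (refl , refl)) = inj₁ (refl , refl)

PredPair-both : ∀ {p} (P : Pred (VR m) p) (ℓ : LV m) → P u → P v → PredPair ℓ u v →
  P (leftPred ℓ) × P (rightPred ℓ)
PredPair-both P _ pu pv (inj₁ (refl , refl)) = pu , pv
PredPair-both P _ pu pv (inj₂ (refl , refl)) = pv , pu

grOf≡∧split≡⇒≡ : grOf ℓ ≡ grOf ℓ′ → LV.k ℓ ≡ LV.k ℓ′ → ℓ ≡ ℓ′
grOf≡∧split≡⇒≡ {ℓ = lv _ _ _ _ _ _} {ℓ′ = lv _ _ _ _ _ _} refl refl = refl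

orient : ℕ → VR m × VR m → VR m × VR m
orient i (u , v) with VR.j u ≟ i
... | yes _ = u , v
... | no  _ = v , u

orient-column : ∀ i → VR.j u ≡ i → orient i (u , v) ≡ (u , v)
orient-column {u = u} i j≡i with VR.j u ≟ i
... | yes _   = refl
... | no  j≢i = contradiction j≡i j≢i

orient-off-column : ∀ i → VR.j u ≢ i → orient i (u , v) ≡ (v , u)
orient-off-column {u = u} i j≢i with VR.j u ≟ i
... | yes j≡i = contradiction j≡i j≢i
... | no  _   = refl

orient-≡⇒SamePair : ∀ i (p q : VR m × VR m) → orient i p ≡ orient i q → SamePair p q
orient-≡⇒SamePair i (u , v) (u′ , v′) eq with VR.j u ≟ i | VR.j u′ ≟ i
orient-≡⇒SamePair i (u , v) (u′ , v′) refl | yes _ | yes _ = inj₁ (refl , refl)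
orient-≡⇒SamePair i (u , v) (u′ , v′) refl | yes _ | no  _ = inj₂ (refl , refl)
orient-≡⇒SamePair i (u , v) (u′ , v′) refl | no  _ | yes _ = inj₂ (refl , refl)
orient-≡⇒SamePair i (u , v) (u′ , v′) refl | no  _ | no  _ = inj₁ (refl , refl)

module _ (G : CNFGrammar) (n : ℕ) where

  preds-not-swapped : IsL G n ℓ → leftPred ℓ ≡ rightPred ℓ′ → rightPred ℓ ≢ leftPred ℓ′
  preds-not-swapped {ℓ = lv _ _ _ _ _ _} {ℓ′ = lv _ _ _ _ _ _} (_ , i≤k , k<j , _) refl refl = <-asym i≤k k<j

  PredPair⇒samePreds : IsL G n ℓ → PredPair ℓ u v → PredPair ℓ′ u v →
    (leftPred ℓ ≡ leftPred ℓ′) × (rightPred ℓ ≡ rightPred ℓ′)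
  PredPair⇒samePreds _ (inj₁ (refl , refl)) (inj₁ (l′ , r′)) = sym l′ , sym r′
  PredPair⇒samePreds _ (inj₂ (refl , refl)) (inj₂ (l′ , r′)) = sym l′ , sym r′
  PredPair⇒samePreds {ℓ′ = ℓ′} isL (inj₁ (refl , refl)) (inj₂ (l′ , r′)) =
    contradiction (sym l′) (preds-not-swapped {ℓ′ = ℓ′} isL (sym r′))
  PredPair⇒samePreds {ℓ′ = ℓ′} isL (inj₂ (refl , refl)) (inj₁ (l′ , r′)) =
    contradiction (sym l′) (preds-not-swapped {ℓ′ = ℓ′} isL (sym r′))

  samePreds⇒≡ : NoSharedRHS G → IsL G n ℓ → IsL G n ℓ′ →
    leftPred ℓ ≡ leftPred ℓ′ → rightPred ℓ ≡ rightPred ℓ′ → ℓ ≡ ℓ′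
  samePreds⇒≡ {ℓ = lv i j k A B C} {ℓ′ = lv _ _ _ A′ _ _}
    (binary-unique , _) (_ , _ , _ , _ , A→BC) (_ , _ , _ , _ , A′→BC) refl refl =
    cong (λ X → lv i j k X B C) (binary-unique A A′ B C A→BC A′→BC)

  Interact⇒UniqueL : NoSharedRHS G → Interact G n u v → UniqueL G n u v
  Interact⇒UniqueL ns (ℓ , isL , pp) = ℓ , isL , pp , λ ℓ′ isL′ pp′ →
    let (l≡ , r≡) = PredPair⇒samePreds {ℓ′ = ℓ} isL′ pp′ pp in samePreds⇒≡ ns isL′ isL l≡ r≡

  InteractingIn : List (VR (nV G)) → Pred (VR (nV G) × VR (nV G)) 0ℓ
  InteractingIn S p = (proj₁ p ∈ S) × (proj₂ p ∈ S) × Interact G n (proj₁ p) (proj₂ p)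

  module _ (i : ℕ) where

    split≡i : IsL G n ℓ → InW G n i (leftPred ℓ) → InW G n i (rightPred ℓ) → LV.k ℓ ≡ i
    split≡i _ (_ , inj₂ k≡i) _ = k≡i
    split≡i _ (_ , inj₁ _) (_ , inj₁ 1+k≡1+i) = suc-injective 1+k≡1+i
    split≡i (_ , i≤k , k<j , _) (_ , inj₁ refl) (_ , inj₂ refl) = contradiction k<j (<-asym i≤k)

    rightPred-off-column : IsL G n ℓ → InW G n i (leftPred ℓ) → InW G n i (rightPred ℓ) →
      VR.j (rightPred ℓ) ≢ i
    rightPred-off-column isL@(_ , _ , k<j , _) l∈W r∈W j≡i =
      <-irrefl (trans (split≡i isL l∈W r∈W) (sym j≡i)) k<j

    orient-preds : IsL G n ℓ → InW G n i (leftPred ℓ) → InW G n i (rightPred ℓ) → PredPair ℓ u v →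
      orient i (u , v) ≡ (leftPred ℓ , rightPred ℓ)
    orient-preds isL l∈W r∈W (inj₁ (refl , refl)) = orient-column i (split≡i isL l∈W r∈W)
    orient-preds isL l∈W r∈W (inj₂ (refl , refl)) = orient-off-column i (rightPred-off-column isL l∈W r∈W)

    module _ {S : List (VR (nV G))} (S⊆W : All (InW G n i) S) where

      preds∈W : ∀ ℓ → u ∈ S → v ∈ S → PredPair ℓ u v → InW G n i (leftPred ℓ) × InW G n i (rightPred ℓ)
      preds∈W ℓ u∈S v∈S = PredPair-both (InW G n i) ℓ (All.lookup S⊆W u∈S) (All.lookup S⊆W v∈S)

      split≡i-in-S : IsL G n ℓ → u ∈ S → v ∈ S → PredPair ℓ u v → LV.k ℓ ≡ i
      split≡i-in-S {ℓ = ℓ} isL u∈S v∈S pp with l∈W , r∈W ← preds∈W ℓ u∈S v∈S pp = split≡i isL l∈W r∈W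

      column? : Decidable (λ (v : VR (nV G)) → VR.j v ≡ i)
      column? v = VR.j v ≟ i

      S-column S-row : List (VR (nV G))
      S-column = filter column? S
      S-row    = filter (∁? column?) S

      orient∈column×row : ∀ {p} → InteractingIn S p → orient i p ∈ cartesianProduct S-column S-row
      orient∈column×row (u∈S , v∈S , ℓ , isL , pp)
        with l∈S , r∈S ← PredPair-both (_∈ S) ℓ u∈S v∈S pp | l∈W , r∈W ← preds∈W ℓ u∈S v∈S pp =
        subst (_∈ cartesianProduct S-column S-row) (sym (orient-preds isL l∈W r∈W pp))
          (∈-cartesianProduct⁺ (∈-filter⁺ column? l∈S (split≡i isL l∈W r∈W))
                               (∈-filter⁺ (∁? column?) r∈S (rightPred-off-column isL l∈W r∈W)))

      interacting-pairs-bound : (P : List (VR (nV G) × VR (nV G))) → All (InteractingIn S) P →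
        AllPairs (λ p q → ¬ SamePair p q) P → 4 * length P ≤ length S * length S
      interacting-pairs-bound P interacting distinct = begin
        4 * length P                                     ≡⟨ cong (4 *_) (length-map (orient i) P) ⟨
        4 * length (map (orient i) P)                    ≤⟨ *-monoʳ-≤ 4 (Unique∧⊆⇒length≤ oriented-unique oriented-⊆) ⟩
        4 * length (cartesianProduct S-column S-row)     ≡⟨ cong (4 *_) (length-cartesianProduct S-column S-row) ⟩
        4 * (length S-column * length S-row)             ≤⟨ 4mn≤[m+n]² (length S-column) (length S-row) ⟩
        (length S-column + length S-row) * (length S-column + length S-row)
                                                         ≡⟨ cong (λ s → s * s) (length-filter+length-filter-∁ column? S) ⟩
        length S * length S                              ∎
        where
        open ≤-Reasoning

        oriented-unique : Unique (map (orient i) P)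
        oriented-unique =
          AllPairs.map⁺ (AllPairs.map (λ {p} {q} ¬same eq → ¬same (orient-≡⇒SamePair i p q eq)) distinct)

        oriented-⊆ : map (orient i) P ⊆ cartesianProduct S-column S-row
        oriented-⊆ q∈ with _ , p∈P , refl ← ∈-map⁻ (orient i) q∈ = orient∈column×row (All.lookup interacting p∈P)

      distinct-pairs⇒distinct-grOf : u ∈ S → v ∈ S → u′ ∈ S → v′ ∈ S → ¬ SamePair (u , v) (u′ , v′) →
        IsL G n ℓ → PredPair ℓ u v → IsL G n ℓ′ → PredPair ℓ′ u′ v′ → grOf ℓ ≢ grOf ℓ′
      distinct-pairs⇒distinct-grOf {u′ = u′} {v′ = v′} {ℓ = ℓ} {ℓ′ = ℓ′}
        u∈S v∈S u′∈S v′∈S distinct isL pp isL′ pp′ gr≡ =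
        distinct (PredPair⇒SamePair {ℓ = ℓ} pp (subst (λ ℓ → PredPair ℓ u′ v′) (sym ℓ≡ℓ′) pp′))
        where
        ℓ≡ℓ′ : ℓ ≡ ℓ′
        ℓ≡ℓ′ = grOf≡∧split≡⇒≡ gr≡
          (trans (split≡i-in-S isL u∈S v∈S pp) (sym (split≡i-in-S isL′ u′∈S v′∈S pp′)))

lemma9 : (G : CNFGrammar) → NoSharedRHS G →
    (n : ℕ) → (w : Vec (Fin (nΣ G)) n) →
    (i : ℕ) → 1 ≤ i → i < n →
    (S : List (VR (nV G))) → Unique S → All (InW G n i) S →
    ((P : List (VR (nV G) × VR (nV G))) →
        All (λ p → (proj₁ p ∈ S) × (proj₂ p ∈ S)
                   × Interact G n (proj₁ p) (proj₂ p)) P →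
        AllPairs (λ p q → ¬ SamePair p q) P →
        4 * length P ≤ length S * length S)
    × (∀ u v → u ∈ S → v ∈ S → Interact G n u v → UniqueL G n u v)
    × (∀ u v u' v' ℓ ℓ' → u ∈ S → v ∈ S → u' ∈ S → v' ∈ S →
        ¬ SamePair (u , v) (u' , v') →
        IsL G n ℓ → PredPair ℓ u v → IsL G n ℓ' → PredPair ℓ' u' v' →
        grOf ℓ ≢ grOf ℓ')
lemma9 G ns n _ i _ _ S _ S⊆W =
    interacting-pairs-bound G n i S⊆W
  , (λ _ _ _ _ → Interact⇒UniqueL G n ns)
  , λ _ _ _ _ ℓ ℓ′ → distinct-pairs⇒distinct-grOf G n i S⊆W {ℓ = ℓ} {ℓ′ = ℓ′}
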